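{- Every chandelier is a restricted frame graph.
   Context: A chandelier is a graph obtained from a tree $T$ by adding a vertex (the pivot) adjacent to every leaf of $T$. A frame is the boundary of an axis-parallel box $[a,b]\times[c,d]\subset\mathbb R^2$ ($a<b$, $c<d$). A graph is a restricted frame graph if there is a family $\{F_v\}$ of frames with $uv$ an edge iff $F_u\cap F_v\neq\emptyset$ ($u\ne v$), such that: (1) no corner of a frame lies on another frame; (2) the left side of any frame meets no other frame; (3) if the right side of a frame meets a second frame, it meets both the top and bottom sides of the second frame; (4) if two frames intersect, no frame is entirely contained in the intersection of the closed regions bounded by them. -}

module Defs where

open import Data.Nat using (ℕ; zero; suc)
open import Data.Fin using (Fin; zero; suc)
open import Data.Rational using (ℚ; _≤_; _<_)
open import Data.Product using (Σ; ∃; _×_; _,_)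
open import Data.Sum using (_⊎_)
open import Data.Empty using (⊥)
open import Data.List using (List; _∷_; []; last)
open import Data.Maybe using (just; nothing)
open import Data.List.Relation.Unary.Unique.Propositional using (Unique)
open import Data.List.Relation.Unary.Linked using (Linked)
open import Relation.Binary.Construct.Closure.ReflexiveTransitive using (Star)
open import Relation.Binary.PropositionalEquality using (_≡_; _≢_)
open import Relation.Nullary using (¬_)

record Graph (n : ℕ) : Set₁ where
  field
    Adj     : Fin n → Fin n → Set
    symm    : ∀ {u v} → Adj u v → Adj v u
    irrefl  : ∀ {u} → ¬ Adj u u
open Graph public

Leaf : ∀ {n} → Graph n → Fin n → Set
Leaf G v = Σ _ λ u → Adj G v u × (∀ w → Adj G v w → w ≡ u)

Connected : ∀ {n} → Graph n → Set
Connected G = ∀ u v → Star (Adj G) u v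

IsCycle : ∀ {n} → Graph n → List (Fin n) → Set
IsCycle G [] = ⊥
IsCycle G (_ ∷ []) = ⊥
IsCycle G (_ ∷ _ ∷ []) = ⊥
IsCycle G cs@(v₀ ∷ v₁ ∷ v₂ ∷ rest) =
  Unique cs × Linked (Adj G) cs × ClosesUp (last cs)
  where
  ClosesUp : _ → Set
  ClosesUp (just vk) = Adj G vk v₀
  ClosesUp nothing   = ⊥

Acyclic : ∀ {n} → Graph n → Set
Acyclic G = ∀ cs → ¬ IsCycle G cs

IsTree : ∀ {n} → Graph n → Set
IsTree G = Connected G × Acyclic G

-- Chandelier of a tree T on Fin n: vertex set Fin (suc n),
-- pivot = zero, tree vertex i = suc i; pivot adjacent to every leaf of T.

chAdj : ∀ {n} → Graph n → Fin (suc n) → Fin (suc n) → Set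
chAdj T zero    zero    = ⊥
chAdj T zero    (suc j) = Leaf T j
chAdj T (suc i) zero    = Leaf T i
chAdj T (suc i) (suc j) = Adj T i j

chandelier : ∀ {n} → Graph n → Graph (suc n)
chandelier {n} T = record { Adj = chAdj T ; symm = λ {u} {v} → sy {u} {v} ; irrefl = λ {u} → ir {u} }
  where
  sy : ∀ {u v} → chAdj T u v → chAdj T v u
  sy {zero}  {zero}  ()
  sy {zero}  {suc j} l = l
  sy {suc i} {zero}  l = l
  sy {suc i} {suc j} a = symm T a
  ir : ∀ {u} → ¬ chAdj T u u
  ir {zero}  ()
  ir {suc i} a = irrefl T a

-- Frames: boundaries of boxes [a,b] × [c,d] with a < b, c < d
-- (coordinates rational)

Point : Set
Point = ℚ × ℚ

record Frame : Set where
  field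
    a b c d : ℚ
    a<b : a < b
    c<d : c < d
open Frame public

OnLeft OnRight OnBottom OnTop : Frame → Point → Set
OnLeft   F (x , y) = x ≡ a F × c F ≤ y × y ≤ d F
OnRight  F (x , y) = x ≡ b F × c F ≤ y × y ≤ d F
OnBottom F (x , y) = y ≡ c F × a F ≤ x × x ≤ b F
OnTop    F (x , y) = y ≡ d F × a F ≤ x × x ≤ b F

OnFrame : Frame → Point → Set
OnFrame F p = OnLeft F p ⊎ OnRight F p ⊎ OnBottom F p ⊎ OnTop F p

InBox : Frame → Point → Set
InBox F (x , y) = (a F ≤ x × x ≤ b F) × (c F ≤ y × y ≤ d F)

Meet : (Point → Set) → (Point → Set) → Set
Meet P Q = ∃ λ p → P p × Q p

IsCorner : Frame → Point → Set
IsCorner F (x , y) = (x ≡ a F ⊎ x ≡ b F) × (y ≡ c F ⊎ y ≡ d F)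

record RestrictedFrameRep {n} (G : Graph n) : Set where
  field
    frame : Fin n → Frame
    edge⇒meet : ∀ u v → u ≢ v → Adj G u v → Meet (OnFrame (frame u)) (OnFrame (frame v))
    meet⇒edge : ∀ u v → u ≢ v → Meet (OnFrame (frame u)) (OnFrame (frame v)) → Adj G u v
    cond1 : ∀ u v → u ≢ v → ∀ p → IsCorner (frame u) p → ¬ OnFrame (frame v) p
    cond2 : ∀ u v → u ≢ v → ¬ Meet (OnLeft (frame u)) (OnFrame (frame v))
    cond3 : ∀ u v → u ≢ v → Meet (OnRight (frame u)) (OnFrame (frame v)) →
            Meet (OnRight (frame u)) (OnTop (frame v)) ×
            Meet (OnRight (frame u)) (OnBottom (frame v))
    cond4 : ∀ u v → u ≢ v → Meet (OnFrame (frame u)) (OnFrame (frame v)) →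
            ∀ w → ¬ (∀ p → OnFrame (frame w) p → InBox (frame u) p × InBox (frame v) p)

RestrictedFrameGraph : ∀ {n} → Graph n → Set
RestrictedFrameGraph G = RestrictedFrameRep G

module Submission where

-- Root the tree T at a vertex r that is not a leaf (one exists unless T is
-- a single edge, whose chandelier is a triangle drawn by hand below).  A tree
-- vertex v at depth d gets the frame [2d+1, R v] × [low v, high v], where
-- R v = 2d+4 for inner vertices and R v = 2H+6 for leaves (H the height),
-- and the intervals [low v, high v] are nested along the tree and disjoint
-- for vertices on different branches.  The pivot gets [0, 2H+5] × [0, high r + 1].
-- Then each child's frame crosses the right side of its parent's frame, each
-- leaf frame crosses the right side of the pivot frame, and every other pair
-- of frames is separated or strictly nested.

open import Defs
open import Data.Nat using (ℕ; zero; suc; _+_; _*_; _∸_; _≤_; _<_; z≤n; s≤s; _≤?_; _<?_; _≤′_; ≤′-refl; ≤′-step)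
import Data.Nat.Properties as ℕₚ
open import Data.Nat.Tactic.RingSolver using (solve-∀)
import Data.Integer as ℤ
import Data.Integer.Properties as ℤₚ
open import Data.Rational as ℚ using (ℚ; *≤*; *<*)
import Data.Rational.Properties as ℚₚ
open import Data.Rational.Literals using (fromℤ)
open import Data.Fin using (Fin; zero; suc; toℕ)
open import Data.Fin.Properties using (_≟_; any?; all?; ¬∀⟶∃¬; toℕ<n; toℕ-injective)
open import Data.List using (List; []; _∷_; last; allFin)
open import Data.List.Extrema.Nat using (argmax; f[xs]≤f[argmax])
open import Data.List.Relation.Unary.All using ([]; lookup)
open import Data.List.Relation.Unary.All.Properties using (¬Any⇒All¬)
open import Data.List.Relation.Unary.AllPairs using ([]; _∷_)
open import Data.List.Relation.Unary.Any as Any using (here; there)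
open import Data.List.Relation.Unary.Linked using (Linked; [-]; _∷_)
open import Data.List.Relation.Unary.Unique.Propositional using (Unique)
open import Data.List.Membership.Propositional using (_∈_)
open import Data.List.Membership.Propositional.Properties using (∈-allFin)
open import Data.Maybe using (just)
open import Data.Product using (Σ; ∃; _×_; _,_; proj₁; proj₂; swap)
open import Data.Sum using (_⊎_; inj₁; inj₂; [_,_]′)
import Data.Sum as Sum
open import Data.Empty using (⊥; ⊥-elim)
open import Data.Unit using (tt)
open import Relation.Nullary using (¬_; yes; no; Dec)
open import Relation.Nullary.Decidable using (_×-dec_; _⊎-dec_; _→-dec_; ¬?; True; toWitness)
open import Relation.Binary.Definitions using (DecidableEquality; tri<; tri≈; tri>)
open import Relation.Binary.Construct.Closure.ReflexiveTransitive using (Star; ε; _◅_; _◅◅_; reverse)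
open import Relation.Binary.PropositionalEquality

ι : ℕ → ℚ
ι n = fromℤ (ℤ.+ n)

ι-mono-≤ : ∀ {m n} → m ≤ n → ι m ℚ.≤ ι n
ι-mono-≤ {m} {n} m≤n =
  *≤* (subst₂ ℤ._≤_ (sym (ℤₚ.*-identityʳ (ℤ.+ m))) (sym (ℤₚ.*-identityʳ (ℤ.+ n))) (ℤ.+≤+ m≤n))

ι-mono-< : ∀ {m n} → m < n → ι m ℚ.< ι n
ι-mono-< {m} {n} m<n =
  *<* (subst₂ ℤ._<_ (sym (ℤₚ.*-identityʳ (ℤ.+ m))) (sym (ℤₚ.*-identityʳ (ℤ.+ n))) (ℤ.+<+ m<n))

ι-cancel-≤ : ∀ {m n} → ι m ℚ.≤ ι n → m ≤ n
ι-cancel-≤ {m} {n} (*≤* h) =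
  ℤₚ.drop‿+≤+ (subst₂ ℤ._≤_ (ℤₚ.*-identityʳ (ℤ.+ m)) (ℤₚ.*-identityʳ (ℤ.+ n)) h)

ℚ<⇒≱ : ∀ {p q} → p ℚ.< q → ¬ q ℚ.≤ p
ℚ<⇒≱ p<q q≤p = ℚₚ.<-irrefl refl (ℚₚ.<-≤-trans p<q q≤p)

Interior : Frame → Point → Set
Interior F (x , y) = (a F ℚ.< x × x ℚ.< b F) × (c F ℚ.< y × y ℚ.< d F)

data Exterior (F : Frame) : Point → Set where
  west  : ∀ {x y} → x ℚ.< a F → Exterior F (x , y)
  east  : ∀ {x y} → b F ℚ.< x → Exterior F (x , y)
  south : ∀ {x y} → y ℚ.< c F → Exterior F (x , y)
  north : ∀ {x y} → d F ℚ.< y → Exterior F (x , y)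

onFrame⇒inBox : ∀ F p → OnFrame F p → InBox F p
onFrame⇒inBox F (x , y) (inj₁ (refl , y-range)) =
  (ℚₚ.≤-refl , ℚₚ.<⇒≤ (a<b F)) , y-range
onFrame⇒inBox F (x , y) (inj₂ (inj₁ (refl , y-range))) =
  (ℚₚ.<⇒≤ (a<b F) , ℚₚ.≤-refl) , y-range
onFrame⇒inBox F (x , y) (inj₂ (inj₂ (inj₁ (refl , x-range)))) =
  x-range , (ℚₚ.≤-refl , ℚₚ.<⇒≤ (c<d F))
onFrame⇒inBox F (x , y) (inj₂ (inj₂ (inj₂ (refl , x-range)))) =
  x-range , (ℚₚ.<⇒≤ (c<d F) , ℚₚ.≤-refl)

exterior⇒¬onFrame : ∀ F p → Exterior F p → ¬ OnFrame F p
exterior⇒¬onFrame F p out on with onFrame⇒inBox F p on | out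
... | (ax , _) , _ | west  x<a = ℚ<⇒≱ x<a ax
... | (_ , xb) , _ | east  b<x = ℚ<⇒≱ b<x xb
... | _ , (cy , _) | south y<c = ℚ<⇒≱ y<c cy
... | _ , (_ , yd) | north d<y = ℚ<⇒≱ d<y yd

interior⇒¬onFrame : ∀ F p → Interior F p → ¬ OnFrame F p
interior⇒¬onFrame F _ ((a<x , _) , _) (inj₁ (refl , _))                = ℚₚ.<-irrefl refl a<x
interior⇒¬onFrame F _ ((_ , x<b) , _) (inj₂ (inj₁ (refl , _)))         = ℚₚ.<-irrefl refl x<b
interior⇒¬onFrame F _ (_ , (c<y , _)) (inj₂ (inj₂ (inj₁ (refl , _))))  = ℚₚ.<-irrefl refl c<y
interior⇒¬onFrame F _ (_ , (_ , y<d)) (inj₂ (inj₂ (inj₂ (refl , _))))  = ℚₚ.<-irrefl refl y<d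

corner⇒side : ∀ F p → IsCorner F p → OnLeft F p ⊎ OnRight F p
corner⇒side F (x , y) (x≡ , y≡) = side x≡ (vertical y≡)
  where
  vertical : y ≡ c F ⊎ y ≡ d F → c F ℚ.≤ y × y ℚ.≤ d F
  vertical (inj₁ refl) = ℚₚ.≤-refl , ℚₚ.<⇒≤ (c<d F)
  vertical (inj₂ refl) = ℚₚ.<⇒≤ (c<d F) , ℚₚ.≤-refl
  side : x ≡ a F ⊎ x ≡ b F → c F ℚ.≤ y × y ℚ.≤ d F → OnLeft F (x , y) ⊎ OnRight F (x , y)
  side (inj₁ x≡a) range = inj₁ (x≡a , range)
  side (inj₂ x≡b) range = inj₂ (x≡b , range)

corner⇒onFrame : ∀ F p → IsCorner F p → OnFrame F p
corner⇒onFrame F p corner with corner⇒side F p corner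
... | inj₁ left  = inj₁ left
... | inj₂ right = inj₂ (inj₁ right)

record GridFrame : Set where
  field
    x₀ x₁ y₀ y₁ : ℕ
    x₀<x₁ : x₀ < x₁
    y₀<y₁ : y₀ < y₁
open GridFrame

⟦_⟧ : GridFrame → Frame
⟦ F ⟧ = record { a = ι (x₀ F) ; b = ι (x₁ F) ; c = ι (y₀ F) ; d = ι (y₁ F)
               ; a<b = ι-mono-< (x₀<x₁ F) ; c<d = ι-mono-< (y₀<y₁ F) }

-- G crosses the right side of F: it enters F through the right side,
-- and its top and bottom sides cut the right side of F.
Crossing : GridFrame → GridFrame → Set
Crossing F G = (x₀ F < x₀ G × x₀ G < x₁ F × x₁ F < x₁ G) × (y₀ F < y₀ G × y₁ G < y₁ F)

Inside : GridFrame → GridFrame → Set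
Inside F G = (x₀ G < x₀ F × x₁ F < x₁ G) × (y₀ G < y₀ F × y₁ F < y₁ G)

data Apart (F G : GridFrame) : Set where
  left-of  : x₁ F < x₀ G → Apart F G
  right-of : x₁ G < x₀ F → Apart F G
  below    : y₁ F < y₀ G → Apart F G
  above    : y₁ G < y₀ F → Apart F G
  inside   : Inside F G → Apart F G
  encloses : Inside G F → Apart F G

apart-sym : ∀ {F G} → Apart F G → Apart G F
apart-sym (left-of h)  = right-of h
apart-sym (right-of h) = left-of h
apart-sym (below h)    = above h
apart-sym (above h)    = below h
apart-sym (inside h)   = encloses h
apart-sym (encloses h) = inside h

meet-sym : ∀ {P Q : Point → Set} → Meet P Q → Meet Q P
meet-sym (p , onP , onQ) = p , onQ , onP

inside⇒interior : ∀ F G p → Inside F G → InBox ⟦ F ⟧ p → Interior ⟦ G ⟧ p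
inside⇒interior F G (x , y) ((gx₀<fx₀ , fx₁<gx₁) , (gy₀<fy₀ , fy₁<gy₁)) ((fx₀≤x , x≤fx₁) , (fy₀≤y , y≤fy₁)) =
  (ℚₚ.<-≤-trans (ι-mono-< gx₀<fx₀) fx₀≤x , ℚₚ.≤-<-trans x≤fx₁ (ι-mono-< fx₁<gx₁)) ,
  (ℚₚ.<-≤-trans (ι-mono-< gy₀<fy₀) fy₀≤y , ℚₚ.≤-<-trans y≤fy₁ (ι-mono-< fy₁<gy₁))

apart⇒¬meet : ∀ F G → Apart F G → ¬ Meet (OnFrame ⟦ F ⟧) (OnFrame ⟦ G ⟧)
apart⇒¬meet F G sep (p , onF , onG) with onFrame⇒inBox ⟦ F ⟧ p onF | onFrame⇒inBox ⟦ G ⟧ p onG | sep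
... | (_ , x≤fx₁) , _ | (gx₀≤x , _) , _ | left-of fx₁<gx₀  = ℚ<⇒≱ (ι-mono-< fx₁<gx₀) (ℚₚ.≤-trans gx₀≤x x≤fx₁)
... | (fx₀≤x , _) , _ | (_ , x≤gx₁) , _ | right-of gx₁<fx₀ = ℚ<⇒≱ (ι-mono-< gx₁<fx₀) (ℚₚ.≤-trans fx₀≤x x≤gx₁)
... | _ , (_ , y≤fy₁) | _ , (gy₀≤y , _) | below fy₁<gy₀    = ℚ<⇒≱ (ι-mono-< fy₁<gy₀) (ℚₚ.≤-trans gy₀≤y y≤fy₁)
... | _ , (fy₀≤y , _) | _ , (_ , y≤gy₁) | above gy₁<fy₀    = ℚ<⇒≱ (ι-mono-< gy₁<fy₀) (ℚₚ.≤-trans fy₀≤y y≤gy₁)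
... | inF | _ | inside F⊂G   = interior⇒¬onFrame ⟦ G ⟧ p (inside⇒interior F G p F⊂G inF) onG
... | _ | inG | encloses G⊂F = interior⇒¬onFrame ⟦ F ⟧ p (inside⇒interior G F p G⊂F inG) onF

module _ (F G : GridFrame) (cross : Crossing F G) where
  private
    fx₀<gx₀ = proj₁ (proj₁ cross)
    gx₀<fx₁ = proj₁ (proj₂ (proj₁ cross))
    fx₁<gx₁ = proj₂ (proj₂ (proj₁ cross))
    fy₀<gy₀ = proj₁ (proj₂ cross)
    gy₁<fy₁ = proj₂ (proj₂ cross)
    <⇒≤ι : ∀ {m n} → m < n → ι m ℚ.≤ ι n
    <⇒≤ι m<n = ι-mono-≤ (ℕₚ.<⇒≤ m<n)

  crossing-top : Meet (OnRight ⟦ F ⟧) (OnTop ⟦ G ⟧)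
  crossing-top = (ι (x₁ F) , ι (y₁ G)) ,
    (refl , <⇒≤ι (ℕₚ.<-trans fy₀<gy₀ (y₀<y₁ G)) , <⇒≤ι gy₁<fy₁) , (refl , <⇒≤ι gx₀<fx₁ , <⇒≤ι fx₁<gx₁)

  crossing-bottom : Meet (OnRight ⟦ F ⟧) (OnBottom ⟦ G ⟧)
  crossing-bottom = (ι (x₁ F) , ι (y₀ G)) ,
    (refl , <⇒≤ι fy₀<gy₀ , <⇒≤ι (ℕₚ.<-trans (y₀<y₁ G) gy₁<fy₁)) , (refl , <⇒≤ι gx₀<fx₁ , <⇒≤ι fx₁<gx₁)

  crossing-meet : Meet (OnFrame ⟦ F ⟧) (OnFrame ⟦ G ⟧)
  crossing-meet with crossing-top
  ... | p , right , top = p , inj₂ (inj₁ right) , inj₂ (inj₂ (inj₂ top))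

  crossing-corner-outside : ∀ p → IsCorner ⟦ F ⟧ p → Exterior ⟦ G ⟧ p
  crossing-corner-outside (x , y) (_ , inj₁ refl) = south (ι-mono-< fy₀<gy₀)
  crossing-corner-outside (x , y) (_ , inj₂ refl) = north (ι-mono-< gy₁<fy₁)

  crossing-left-outside : ∀ p → OnLeft ⟦ F ⟧ p → Exterior ⟦ G ⟧ p
  crossing-left-outside (x , y) (refl , _) = west (ι-mono-< fx₀<gx₀)

  crossed-left-inside : ∀ p → OnLeft ⟦ G ⟧ p → Interior ⟦ F ⟧ p
  crossed-left-inside (x , y) (refl , gy₀≤y , y≤gy₁) =
    (ι-mono-< fx₀<gx₀ , ι-mono-< gx₀<fx₁) ,
    (ℚₚ.<-≤-trans (ι-mono-< fy₀<gy₀) gy₀≤y , ℚₚ.≤-<-trans y≤gy₁ (ι-mono-< gy₁<fy₁))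

  crossed-right-outside : ∀ p → OnRight ⟦ G ⟧ p → Exterior ⟦ F ⟧ p
  crossed-right-outside (x , y) (refl , _) = east (ι-mono-< fx₁<gx₁)

  crossed-corner-off : ∀ p → IsCorner ⟦ G ⟧ p → ¬ OnFrame ⟦ F ⟧ p
  crossed-corner-off p corner with corner⇒side ⟦ G ⟧ p corner
  ... | inj₁ left  = interior⇒¬onFrame ⟦ F ⟧ p (crossed-left-inside p left)
  ... | inj₂ right = exterior⇒¬onFrame ⟦ F ⟧ p (crossed-right-outside p right)

-- The box of W lies in [x₀ G, x₁ F] × [y₀ G, y₁ G]; when G crosses the
-- right side of F this rectangle is the intersection of their boxes.
InOverlap : GridFrame → GridFrame → GridFrame → Set
InOverlap W F G = (x₀ G ≤ x₀ W × x₁ W ≤ x₁ F) × (y₀ G ≤ y₀ W × y₁ W ≤ y₁ G)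

-- a frame lying in the boxes of F and of G lies in this rectangle
-- (it suffices to look at its lower-left and upper-right corners)
inBoxes⇒inOverlap : ∀ W F G →
  (∀ p → OnFrame ⟦ W ⟧ p → InBox ⟦ F ⟧ p × InBox ⟦ G ⟧ p) → InOverlap W F G
inBoxes⇒inOverlap W F G inBoxes
  with inBoxes _ (corner⇒onFrame ⟦ W ⟧ _ (inj₁ refl , inj₁ refl))
     | inBoxes _ (corner⇒onFrame ⟦ W ⟧ _ (inj₂ refl , inj₂ refl))
... | _ , ((gx₀≤wx₀ , _) , (gy₀≤wy₀ , _)) | ((_ , wx₁≤fx₁) , _) , (_ , (_ , wy₁≤gy₁)) =
  (ι-cancel-≤ gx₀≤wx₀ , ι-cancel-≤ wx₁≤fx₁) , (ι-cancel-≤ gy₀≤wy₀ , ι-cancel-≤ wy₁≤gy₁)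

-- A restricted frame representation from combinatorial data: it suffices
-- that adjacent vertices have crossing frames whose overlap contains no
-- frame, and non-adjacent vertices have apart frames.
module FrameLayout {N} (G : Graph N) (frame : Fin N → GridFrame) where

  -- condition (4) for frames u, v where v crosses the right side of u
  Clear : Fin N → Fin N → Set
  Clear u v = ∀ w → ¬ InOverlap (frame w) (frame u) (frame v)

  data Fits (u v : Fin N) : Set where
    crosses  : Adj G u v → Crossing (frame u) (frame v) → Clear u v → Fits u v
    crossed  : Adj G u v → Crossing (frame v) (frame u) → Clear v u → Fits u v
    separate : ¬ Adj G u v → Apart (frame u) (frame v) → Fits u v

  fits-sym : ∀ {u v} → Fits u v → Fits v u
  fits-sym (crosses adj cross clear)  = crossed (symm G adj) cross clear
  fits-sym (crossed adj cross clear)  = crosses (symm G adj) cross clear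
  fits-sym (separate ¬adj sep)        = separate (λ adj → ¬adj (symm G adj)) (apart-sym sep)

  module _ (fits : ∀ u v → u ≢ v → Fits u v) where
    private
      F : Fin N → Frame
      F u = ⟦ frame u ⟧

    representation : RestrictedFrameRep G
    representation = record
      { frame = F
      ; edge⇒meet = edge⇒meet
      ; meet⇒edge = meet⇒edge
      ; cond1 = corner-off
      ; cond2 = left-free
      ; cond3 = right-cuts
      ; cond4 = overlap-free
      }
      where
      edge⇒meet : ∀ u v → u ≢ v → Adj G u v → Meet (OnFrame (F u)) (OnFrame (F v))
      edge⇒meet u v u≢v adj with fits u v u≢v
      ... | crosses _ cross _ = crossing-meet (frame u) (frame v) cross
      ... | crossed _ cross _ = meet-sym (crossing-meet (frame v) (frame u) cross)
      ... | separate ¬adj _   = ⊥-elim (¬adj adj)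

      meet⇒edge : ∀ u v → u ≢ v → Meet (OnFrame (F u)) (OnFrame (F v)) → Adj G u v
      meet⇒edge u v u≢v meet with fits u v u≢v
      ... | crosses adj _ _ = adj
      ... | crossed adj _ _ = adj
      ... | separate _ sep  = ⊥-elim (apart⇒¬meet (frame u) (frame v) sep meet)

      corner-off : ∀ u v → u ≢ v → ∀ p → IsCorner (F u) p → ¬ OnFrame (F v) p
      corner-off u v u≢v p corner with fits u v u≢v
      ... | crosses _ cross _ =
        exterior⇒¬onFrame (F v) p (crossing-corner-outside (frame u) (frame v) cross p corner)
      ... | crossed _ cross _ = crossed-corner-off (frame v) (frame u) cross p corner
      ... | separate _ sep = λ on →
        apart⇒¬meet (frame u) (frame v) sep (p , corner⇒onFrame (F u) p corner , on)

      left-free : ∀ u v → u ≢ v → ¬ Meet (OnLeft (F u)) (OnFrame (F v))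
      left-free u v u≢v (p , left , on) with fits u v u≢v
      ... | crosses _ cross _ =
        exterior⇒¬onFrame (F v) p (crossing-left-outside (frame u) (frame v) cross p left) on
      ... | crossed _ cross _ =
        interior⇒¬onFrame (F v) p (crossed-left-inside (frame v) (frame u) cross p left) on
      ... | separate _ sep = apart⇒¬meet (frame u) (frame v) sep (p , inj₁ left , on)

      right-cuts : ∀ u v → u ≢ v → Meet (OnRight (F u)) (OnFrame (F v)) →
                   Meet (OnRight (F u)) (OnTop (F v)) × Meet (OnRight (F u)) (OnBottom (F v))
      right-cuts u v u≢v (p , right , on) with fits u v u≢v
      ... | crosses _ cross _ =
        crossing-top (frame u) (frame v) cross , crossing-bottom (frame u) (frame v) cross
      ... | crossed _ cross _ =
        ⊥-elim (exterior⇒¬onFrame (F v) p (crossed-right-outside (frame v) (frame u) cross p right) on)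
      ... | separate _ sep =
        ⊥-elim (apart⇒¬meet (frame u) (frame v) sep (p , inj₂ (inj₁ right) , on))

      overlap-free : ∀ u v → u ≢ v → Meet (OnFrame (F u)) (OnFrame (F v)) →
                     ∀ w → ¬ (∀ p → OnFrame (F w) p → InBox (F u) p × InBox (F v) p)
      overlap-free u v u≢v meet w inBoxes with fits u v u≢v
      ... | crosses _ _ clear = clear w (inBoxes⇒inOverlap (frame w) (frame u) (frame v) inBoxes)
      ... | crossed _ _ clear =
        clear w (inBoxes⇒inOverlap (frame w) (frame v) (frame u) (λ p on → swap (inBoxes p on)))
      ... | separate _ sep = apart⇒¬meet (frame u) (frame v) sep meet

Path : {A : Set} → (A → A → Set) → A → List A → A → Set
Path R x []       y = x ≡ y
Path R x (z ∷ zs) y = R x z × Path R z zs y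

record SimplePath {A : Set} (R : A → A → Set) (x y : A) : Set where
  constructor simplePath
  field
    via      : List A
    steps    : Path R x via y
    distinct : Unique (x ∷ via)

module _ {A : Set} {R : A → A → Set} where

  path-last : ∀ {x y} zs → Path R x zs y → last (x ∷ zs) ≡ just y
  path-last []           refl         = refl
  path-last (z ∷ [])     (_ , refl)   = refl
  path-last (z ∷ w ∷ zs) (_ , steps)  = path-last (w ∷ zs) steps

  suffix : ∀ {x z y} zs → x ∈ (z ∷ zs) → Path R z zs y → Unique (z ∷ zs) → SimplePath R x y
  suffix zs       (here refl) steps      distinct       = simplePath zs steps distinct
  suffix (w ∷ zs) (there x∈)  (_ , steps) (_ ∷ distinct) = suffix zs x∈ steps distinct

  simplify : DecidableEquality A → ∀ {x y} → Star R x y → SimplePath R x y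
  simplify _≟ᴬ_ ε = simplePath [] refl ([] ∷ [])
  simplify _≟ᴬ_ {x} (step ◅ walk) with simplify _≟ᴬ_ walk
  ... | simplePath zs steps distinct with Any.any? (x ≟ᴬ_) (_ ∷ zs)
  ... | yes x∈ = suffix zs x∈ steps distinct
  ... | no x∉  = simplePath (_ ∷ zs) (step , steps) (¬Any⇒All¬ _ x∉ ∷ distinct)

module _ {n} (G : Graph n) (acyclic : Acyclic G)
         {R : Fin n → Fin n → Set} (R⊆Adj : ∀ {u v} → R u v → Adj G u v) where

  private
    path⇒linked : ∀ {x y} zs → Path R x zs y → Linked (Adj G) (x ∷ zs)
    path⇒linked []       _            = [-]
    path⇒linked (z ∷ zs) (step , rest) = R⊆Adj step ∷ path⇒linked zs rest

  no-shortcut : ∀ {x z w y} zs → Path R x (z ∷ w ∷ zs) y → Unique (x ∷ z ∷ w ∷ zs) → ¬ Adj G y x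
  no-shortcut {x} {z} {w} zs steps distinct closing = acyclic (x ∷ z ∷ w ∷ zs) cycle
    where
    cycle : IsCycle G (x ∷ z ∷ w ∷ zs)
    cycle rewrite path-last (z ∷ w ∷ zs) steps = distinct , path⇒linked (z ∷ w ∷ zs) steps , closing

  edge-only-path : ∀ {x y} → Adj G x y → SimplePath R x y → R x y
  edge-only-path adj (simplePath []           refl         _)        = ⊥-elim (irrefl G adj)
  edge-only-path adj (simplePath (_ ∷ [])     (step , refl) _)       = step
  edge-only-path adj (simplePath (_ ∷ _ ∷ zs) steps        distinct) =
    ⊥-elim (no-shortcut zs steps distinct (symm G adj))

-- Adjacency in a tree is decidable: x and y are adjacent exactly when the
-- simple path between them has a single step.
adjacent? : ∀ {n} (T : Graph n) → IsTree T → ∀ x y → Dec (Adj T x y)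
adjacent? T (connected , acyclic) x y with simplify _≟_ (connected x y)
... | simplePath []           refl         _        = no (irrefl T)
... | simplePath (_ ∷ [])     (adj , refl) _        = yes adj
... | simplePath (_ ∷ _ ∷ zs) steps        distinct =
  no λ adj → no-shortcut T acyclic (λ a → a) zs steps distinct (symm T adj)

record Rooting (N : ℕ) : Set where
  field
    root   : Fin N
    parent : Fin N → Fin N
    depth  : Fin N → ℕ
    depth-parent : ∀ {v} → v ≢ root → suc (depth (parent v)) ≡ depth v

module Ancestry {N} (ρ : Rooting N) where
  open Rooting ρ

  data _≺_ (u : Fin N) : Fin N → Set where
    is-parent  : ∀ {v} → v ≢ root → u ≡ parent v → u ≺ v
    via-parent : ∀ {v} → v ≢ root → u ≺ parent v → u ≺ v

  _≼_ : Fin N → Fin N → Set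
  u ≼ v = u ≡ v ⊎ u ≺ v

  ≺-depth : ∀ {u v} → u ≺ v → depth u < depth v
  ≺-depth (is-parent v≢r refl) = ℕₚ.≤-reflexive (depth-parent v≢r)
  ≺-depth (via-parent v≢r u≺p) = ℕₚ.<-trans (≺-depth u≺p) (ℕₚ.≤-reflexive (depth-parent v≢r))

  ≺-irrefl : ∀ {u} → ¬ u ≺ u
  ≺-irrefl u≺u = ℕₚ.<-irrefl refl (≺-depth u≺u)

  ≺-asym : ∀ {u v} → u ≺ v → ¬ v ≺ u
  ≺-asym u≺v v≺u = ℕₚ.<-asym (≺-depth u≺v) (≺-depth v≺u)

  depth-pos : ∀ {v} → v ≢ root → 1 ≤ depth v
  depth-pos v≢r = ℕₚ.≤-trans (s≤s z≤n) (ℕₚ.≤-reflexive (depth-parent v≢r))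

  root≺ : ∀ {v} → v ≢ root → root ≺ v
  root≺ {v} v≢r = go (depth v) ℕₚ.≤-refl v≢r
    where
    go : ∀ fuel {v} → depth v ≤ fuel → v ≢ root → root ≺ v
    go zero    {v} bound v≢r = ⊥-elim (ℕₚ.<-irrefl refl (ℕₚ.≤-trans (depth-pos v≢r) bound))
    go (suc f) {v} bound v≢r with parent v ≟ root
    ... | yes p≡r = is-parent v≢r (sym p≡r)
    ... | no  p≢r = via-parent v≢r (go f (ℕₚ.≤-pred (subst (_≤ suc f) (sym (depth-parent v≢r)) bound)) p≢r)

  ≼-step : ∀ {a u} → u ≢ root → a ≼ parent u → a ≺ u
  ≼-step u≢r (inj₁ refl) = is-parent u≢r refl
  ≼-step u≢r (inj₂ a≺p)  = via-parent u≢r a≺p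

  Siblings : Fin N → Fin N → Set
  Siblings a b = a ≢ b × (a ≢ root × b ≢ root) × parent a ≡ parent b

  data Position (u v : Fin N) : Set where
    same       : u ≡ v → Position u v
    ancestor   : u ≺ v → Position u v
    descendant : v ≺ u → Position u v
    branches   : ∀ {a b} → Siblings a b → a ≼ u → b ≼ v → Position u v

  position-flip : ∀ {u v} → Position u v → Position v u
  position-flip (same refl)           = same refl
  position-flip (ancestor u≺v)        = descendant u≺v
  position-flip (descendant v≺u)      = ancestor v≺u
  position-flip (branches (a≢b , (a≢r , b≢r) , pa≡pb) a≼u b≼v) =
    branches ((λ b≡a → a≢b (sym b≡a)) , (b≢r , a≢r) , sym pa≡pb) b≼v a≼u

  position-step : ∀ {u v} → u ≢ root → depth v ≤ depth u → Position (parent u) v → Position u v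
  position-step u≢r _ (same refl) = descendant (is-parent u≢r refl)
  position-step {u} {v} u≢r _ (ancestor (is-parent v≢r pu≡pv)) with u ≟ v
  ... | yes u≡v = same u≡v
  ... | no  u≢v = branches (u≢v , (u≢r , v≢r) , pu≡pv) (inj₁ refl) (inj₁ refl)
  position-step {u} {v} u≢r v≤u (ancestor (via-parent v≢r pu≺pv)) = ⊥-elim (ℕₚ.<-irrefl refl deeper)
    where
    deeper : depth u < depth u
    deeper = begin-strict
      depth u                  ≡⟨ depth-parent u≢r ⟨
      suc (depth (parent u))   ≤⟨ ≺-depth pu≺pv ⟩
      depth (parent v)         <⟨ ℕₚ.≤-reflexive (depth-parent v≢r) ⟩
      depth v                  ≤⟨ v≤u ⟩
      depth u                  ∎
      where open ℕₚ.≤-Reasoning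
  position-step u≢r _ (descendant v≺pu) = descendant (via-parent u≢r v≺pu)
  position-step u≢r _ (branches sib a≼pu b≼v) = branches sib (inj₂ (≼-step u≢r a≼pu)) b≼v

  -- every pair of vertices has a position; induction on the sum of depths
  position : ∀ u v → Position u v
  position u v = go (suc (depth u + depth v)) u v ℕₚ.≤-refl
    where
    shrink : ∀ {u k fuel} → u ≢ root → depth u + k < suc fuel → depth (parent u) + k < fuel
    shrink {u} {k} {fuel} u≢r bound =
      subst (λ d → d + k ≤ fuel) (sym (depth-parent u≢r)) (ℕₚ.≤-pred bound)

    go : ∀ fuel u v → depth u + depth v < fuel → Position u v
    go zero u v ()
    go (suc fuel) u v bound with u ≟ root | v ≟ root
    ... | yes refl | yes refl = same refl
    ... | yes refl | no v≢r   = ancestor (root≺ v≢r)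
    ... | no u≢r   | yes refl = descendant (root≺ u≢r)
    ... | no u≢r   | no v≢r with depth v ≤? depth u
    ...   | yes v≤u = position-step u≢r v≤u (go fuel (parent u) v (shrink u≢r bound))
    ...   | no  v≰u = position-flip (position-step v≢r (ℕₚ.<⇒≤ (ℕₚ.≰⇒> v≰u))
                        (go fuel (parent v) u (shrink v≢r (subst (_< suc fuel) (ℕₚ.+-comm (depth u) (depth v)) bound))))

-- Nested intervals: vertex v gets [low v, high v]; the interval of a child
-- lies strictly inside that of its parent, in slot toℕ v of N slots.
module Intervals {N} (ρ : Rooting N) where
  open Rooting ρ
  open Ancestry ρ

  height : ℕ
  height = depth (argmax depth root (allFin N))

  depth≤height : ∀ v → depth v ≤ height
  depth≤height v = lookup (f[xs]≤f[argmax] root (allFin N)) (∈-allFin v)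

  -- room needed by a vertex whose subtree may reach t levels further down
  span : ℕ → ℕ
  span zero    = 1
  span (suc t) = suc N * suc (span t)

  width : Fin N → ℕ
  width v = span (height ∸ depth v)

  width-parent : ∀ {v} → v ≢ root → width (parent v) ≡ suc N * suc (width v)
  width-parent {v} v≢r = begin
    span (height ∸ depth (parent v))               ≡⟨ cong span (∸-step height (depth (parent v)) below-height) ⟩
    span (suc (height ∸ suc (depth (parent v))))   ≡⟨ cong (λ d → span (suc (height ∸ d))) (depth-parent v≢r) ⟩
    span (suc (height ∸ depth v))                  ∎
    where
    open ≡-Reasoning
    below-height : suc (depth (parent v)) ≤ height
    below-height = subst (_≤ height) (sym (depth-parent v≢r)) (depth≤height v)
    ∸-step : ∀ h k → suc k ≤ h → h ∸ k ≡ suc (h ∸ suc k)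
    ∸-step (suc h) zero    _         = refl
    ∸-step (suc h) (suc k) (s≤s k<h) = ∸-step h k k<h

  -- the lower end, by recursion along the path to the root: a child starts
  -- in slot toℕ v of its parent's interval, each slot one unit wider than it
  lowAt : ℕ → Fin N → ℕ
  lowAt zero    v = 1
  lowAt (suc k) v = lowAt k (parent v) + suc (toℕ v * suc (width v))

  low high : Fin N → ℕ
  low v  = lowAt (depth v) v
  high v = low v + width v

  low-pos : ∀ v → 1 ≤ low v
  low-pos v = go (depth v) v
    where
    go : ∀ k v → 1 ≤ lowAt k v
    go zero    v = ℕₚ.≤-refl
    go (suc k) v = ℕₚ.≤-trans (go k (parent v)) (ℕₚ.m≤m+n _ _)

  low<high : ∀ v → low v < high v
  low<high v = ℕₚ.m<m+n (low v) (span-pos (height ∸ depth v))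
    where
    span-pos : ∀ t → 0 < span t
    span-pos zero    = s≤s z≤n
    span-pos (suc t) = s≤s z≤n

  low-child : ∀ {v} → v ≢ root → low v ≡ low (parent v) + suc (toℕ v * suc (width v))
  low-child {v} v≢r = cong (λ k → lowAt k v) (sym (depth-parent v≢r))

  high-child : ∀ {v} → v ≢ root → high v ≡ low (parent v) + suc (toℕ v) * suc (width v)
  high-child {v} v≢r = begin
    low v + width v                                          ≡⟨ cong (_+ width v) (low-child v≢r) ⟩
    low (parent v) + suc (toℕ v * suc (width v)) + width v   ≡⟨ slots (low (parent v)) (toℕ v) (width v) ⟩
    low (parent v) + suc (toℕ v) * suc (width v)             ∎
    where
    open ≡-Reasoning
    slots : ∀ L i W → L + suc (i * suc W) + W ≡ L + suc i * suc W
    slots = solve-∀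

  child-inside : ∀ {v} → v ≢ root → low (parent v) < low v × high v < high (parent v)
  child-inside {v} v≢r = lower , upper
    where
    open ℕₚ.≤-Reasoning
    lower : low (parent v) < low v
    lower = begin-strict
      low (parent v)                                 <⟨ ℕₚ.m<m+n _ (s≤s z≤n) ⟩
      low (parent v) + suc (toℕ v * suc (width v))   ≡⟨ low-child v≢r ⟨
      low v                                          ∎
    upper : high v < high (parent v)
    upper = begin-strict
      high v                                         ≡⟨ high-child v≢r ⟩
      low (parent v) + suc (toℕ v) * suc (width v)   <⟨ ℕₚ.+-monoʳ-< (low (parent v))
                                                          (ℕₚ.*-monoˡ-< (suc (width v)) (s≤s (toℕ<n v))) ⟩
      low (parent v) + suc N * suc (width v)         ≡⟨ cong (low (parent v) +_) (width-parent v≢r) ⟨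
      high (parent v)                                ∎

  siblings-apart : ∀ {u v} → Siblings u v → toℕ u < toℕ v → high u < low v
  siblings-apart {u} {v} (_ , (u≢r , v≢r) , pu≡pv) u<v = begin-strict
    high u                                          ≡⟨ high-child u≢r ⟩
    low (parent u) + suc (toℕ u) * suc (width u)    ≤⟨ ℕₚ.+-monoʳ-≤ (low (parent u)) (ℕₚ.*-monoˡ-≤ (suc (width u)) u<v) ⟩
    low (parent u) + toℕ v * suc (width u)          <⟨ ℕₚ.+-monoʳ-< (low (parent u)) (ℕₚ.n<1+n _) ⟩
    low (parent u) + suc (toℕ v * suc (width u))    ≡⟨ cong₂ (λ p w → low p + suc (toℕ v * suc w)) pu≡pv same-width ⟩
    low (parent v) + suc (toℕ v * suc (width v))    ≡⟨ low-child v≢r ⟨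
    low v                                           ∎
    where
    open ℕₚ.≤-Reasoning
    same-width : width u ≡ width v
    same-width = cong (λ d → span (height ∸ d))
      (trans (sym (depth-parent u≢r)) (trans (cong (λ p → suc (depth p)) pu≡pv) (depth-parent v≢r)))

  ancestor-inside : ∀ {u v} → u ≺ v → low u < low v × high v < high u
  ancestor-inside (is-parent v≢r refl) = child-inside v≢r
  ancestor-inside (via-parent v≢r u≺p) with ancestor-inside u≺p | child-inside v≢r
  ... | lu<lp , hp<hu | lp<lv , hv<hp = ℕₚ.<-trans lu<lp lp<lv , ℕₚ.<-trans hv<hp hp<hu

  ancestor-inside-≼ : ∀ {u v} → u ≼ v → low u ≤ low v × high v ≤ high u
  ancestor-inside-≼ (inj₁ refl) = ℕₚ.≤-refl , ℕₚ.≤-refl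
  ancestor-inside-≼ (inj₂ u≺v)  with ancestor-inside u≺v
  ... | lu<lv , hv<hu = ℕₚ.<⇒≤ lu<lv , ℕₚ.<⇒≤ hv<hu

  Disjoint : Fin N → Fin N → Set
  Disjoint u v = high u < low v ⊎ high v < low u

  ancestor⇒¬disjoint : ∀ {u v} → u ≺ v → ¬ Disjoint u v
  ancestor⇒¬disjoint {u} {v} u≺v disjoint with ancestor-inside u≺v | disjoint
  ... | _ , hv<hu | inj₁ hu<lv =
    ℕₚ.<-irrefl refl (ℕₚ.<-trans (low<high v) (ℕₚ.<-trans hv<hu hu<lv))
  ... | lu<lv , _ | inj₂ hv<lu =
    ℕₚ.<-irrefl refl (ℕₚ.<-trans lu<lv (ℕₚ.<-trans (low<high v) hv<lu))

  branches-disjoint : ∀ {a b u v} → Siblings a b → a ≼ u → b ≼ v → Disjoint u v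
  branches-disjoint {a} {b} {u} {v} sib@(a≢b , (a≢r , b≢r) , pa≡pb) a≼u b≼v
    with ancestor-inside-≼ a≼u | ancestor-inside-≼ b≼v | ℕₚ.<-cmp (toℕ a) (toℕ b)
  ... | _ , hu≤ha | lb≤lv , _ | tri< a<b _ _ =
    inj₁ (ℕₚ.≤-<-trans hu≤ha (ℕₚ.<-≤-trans (siblings-apart sib a<b) lb≤lv))
  ... | _ | _ | tri≈ _ a≡b _ = ⊥-elim (a≢b (toℕ-injective a≡b))
  ... | la≤lu , _ | _ , hv≤hb | tri> _ _ b<a =
    inj₂ (ℕₚ.≤-<-trans hv≤hb (ℕₚ.<-≤-trans (siblings-apart sib′ b<a) la≤lu))
    where sib′ = (λ b≡a → a≢b (sym b≡a)) , (b≢r , a≢r) , sym pa≡pb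

  data Relative (u v : Fin N) : Set where
    same       : u ≡ v → Relative u v
    ancestor   : u ≺ v → Relative u v
    descendant : v ≺ u → Relative u v
    disjoint   : Disjoint u v → Relative u v

  relative : ∀ u v → Relative u v
  relative u v with position u v
  ... | same u≡v            = same u≡v
  ... | ancestor u≺v        = ancestor u≺v
  ... | descendant v≺u      = descendant v≺u
  ... | branches sib a≼u b≼v = disjoint (branches-disjoint sib a≼u b≼v)

  inside⇒≼ : ∀ {v w} → low v ≤ low w → high w ≤ high v → v ≼ w
  inside⇒≼ {v} {w} lv≤lw hw≤hv with relative v w
  ... | same v≡w = inj₁ v≡w
  ... | ancestor v≺w = inj₂ v≺w
  ... | descendant w≺v = ⊥-elim (ℕₚ.<⇒≱ (proj₁ (ancestor-inside w≺v)) lv≤lw)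
  ... | disjoint (inj₁ hv<lw) = ⊥-elim (ℕₚ.<⇒≱ hv<lw (ℕₚ.≤-trans (ℕₚ.<⇒≤ (low<high w)) hw≤hv))
  ... | disjoint (inj₂ hw<lv) = ⊥-elim (ℕₚ.<⇒≱ hw<lv (ℕₚ.≤-trans lv≤lw (ℕₚ.<⇒≤ (low<high w))))

least : {P : ℕ → Set} → (∀ k → Dec (P k)) → (∀ {k} → P k → P (suc k)) →
        ∀ {L} → P L → Σ ℕ λ k → P k × (∀ {j} → P j → k ≤ j)
least {P} P? up = go _
  where
  up* : ∀ {j k} → j ≤′ k → P j → P k
  up* ≤′-refl       pj = pj
  up* (≤′-step j≤k) pj = up (up* j≤k pj)

  go : ∀ L → P L → Σ ℕ λ k → P k × (∀ {j} → P j → k ≤ j)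
  go zero    p0 = zero , p0 , λ _ → z≤n
  go (suc L) pL with P? L
  ... | yes pL′ = go L pL′
  ... | no ¬pL′ = suc L , pL , λ pj → ℕₚ.≰⇒> (λ j≤L → ¬pL′ (up* (ℕₚ.≤⇒≤′ j≤L) pj))

leaf? : ∀ {n} (T : Graph n) → IsTree T → ∀ v → Dec (Leaf T v)
leaf? T tree v with any? (adjacent? T tree v)
... | no  isolated = no λ { (u , adj , _) → isolated (u , adj) }
... | yes (u , adj) with all? (λ w → adjacent? T tree v w →-dec w ≟ u)
...   | yes unique = yes (u , adj , unique)
...   | no  ¬unique = no λ { (u′ , adj′ , unique′) →
          ¬unique λ w adjw → trans (unique′ w adjw) (sym (unique′ u adj)) }

-- Breadth-first rooting of a tree at r: depth is the distance to r and the
-- parent of v ≠ r is a neighbour one step closer to r.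
module TreeRooting {N} (T : Graph N) (tree : IsTree T) (r : Fin N) where

  Reach : ℕ → Fin N → Set
  Reach zero    v = v ≡ r
  Reach (suc k) v = Reach k v ⊎ ∃ λ u → Reach k u × Adj T u v

  reach? : ∀ k v → Dec (Reach k v)
  reach? zero    v = v ≟ r
  reach? (suc k) v = reach? k v ⊎-dec any? (λ u → reach? k u ×-dec adjacent? T tree u v)

  reach-walk : ∀ {x v k} → Star (Adj T) x v → Reach k x → ∃ λ j → Reach j v
  reach-walk ε          reach = _ , reach
  reach-walk (adj ◅ walk) reach = reach-walk walk (inj₂ (_ , reach , adj))

  distance : ∀ v → Σ ℕ λ k → Reach k v × (∀ {j} → Reach j v → k ≤ j)
  distance v = least (λ k → reach? k v) inj₁ (proj₂ (reach-walk (proj₁ tree r v) refl))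

  depth : Fin N → ℕ
  depth v = proj₁ (distance v)

  reach-depth : ∀ v → Reach (depth v) v
  reach-depth v = proj₁ (proj₂ (distance v))

  depth-least : ∀ {j v} → Reach j v → depth v ≤ j
  depth-least {v = v} = proj₂ (proj₂ (distance v))

  predecessor : ∀ v → depth v ≡ 0 ⊎ Σ (Fin N) λ u → Adj T u v × suc (depth u) ≡ depth v
  predecessor v with depth v | reach-depth v | (λ {j} → depth-least {j} {v})
  ... | zero  | _                    | _        = inj₁ refl
  ... | suc k | inj₁ near            | minimal  = ⊥-elim (ℕₚ.<-irrefl refl (minimal near))
  ... | suc k | inj₂ (u , ru , adj)  | minimal  =
    inj₂ (u , adj , ℕₚ.≤-antisym (s≤s (depth-least ru)) (minimal (inj₂ (u , reach-depth u , adj))))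

  parent : Fin N → Fin N
  parent v = [ (λ _ → v) , proj₁ ]′ (predecessor v)

  parent-spec : ∀ {v} → v ≢ r → Adj T (parent v) v × suc (depth (parent v)) ≡ depth v
  parent-spec {v} v≢r with predecessor v
  ... | inj₁ depth≡0 = ⊥-elim (v≢r (subst (λ k → Reach k v) depth≡0 (reach-depth v)))
  ... | inj₂ (_ , adj , step) = adj , step

  rooting : Rooting N
  rooting = record { root = r ; parent = parent ; depth = depth
                   ; depth-parent = λ v≢r → proj₂ (parent-spec v≢r) }

  open Ancestry rooting

  parent-adj : ∀ {v} → v ≢ r → Adj T (parent v) v
  parent-adj v≢r = proj₁ (parent-spec v≢r)

  Link : Fin N → Fin N → Set
  Link x y = (y ≢ r × x ≡ parent y) ⊎ (x ≢ r × y ≡ parent x)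

  link-sym : ∀ {x y} → Link x y → Link y x
  link-sym (inj₁ l) = inj₂ l
  link-sym (inj₂ l) = inj₁ l

  link⇒adj : ∀ {x y} → Link x y → Adj T x y
  link⇒adj (inj₁ (y≢r , refl)) = parent-adj y≢r
  link⇒adj (inj₂ (x≢r , refl)) = symm T (parent-adj x≢r)

  to-root : ∀ v → Star Link v r
  to-root v = go (depth v) v refl
    where
    go : ∀ k v → depth v ≡ k → Star Link v r
    go k v d with v ≟ r
    go k       v d | yes refl = ε
    go zero    v d | no v≢r = ⊥-elim (ℕₚ.<-irrefl refl (ℕₚ.≤-trans (depth-pos v≢r) (ℕₚ.≤-reflexive d)))
    go (suc k) v d | no v≢r =
      inj₂ (v≢r , refl) ◅ go k (parent v) (ℕₚ.suc-injective (trans (proj₂ (parent-spec v≢r)) d))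

  -- every edge of the tree joins a vertex and its parent: the walk through
  -- the root contains a simple path, which must be the edge itself
  edge⇒link : ∀ {u v} → Adj T u v → Link u v
  edge⇒link {u} {v} adj =
    edge-only-path T (proj₂ tree) link⇒adj adj (simplify _≟_ (to-root u ◅◅ reverse link-sym (to-root v)))

  module _ (root-inner : ¬ Leaf T r) where

    -- the root is inner by assumption; any other parent has two distinct
    -- neighbours, its child and its own parent
    parent-not-leaf : ∀ {c} → c ≢ r → ¬ Leaf T (parent c)
    parent-not-leaf {c} c≢r leaf with parent c ≟ r
    ... | yes p≡r = root-inner (subst (Leaf T) p≡r leaf)
    ... | no  p≢r with leaf
    ...   | w , _ , unique = ≺-irrefl (subst (_≺ c) (sym c≡grandparent) (via-parent c≢r (is-parent p≢r refl)))
      where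
      c≡grandparent : c ≡ parent (parent c)
      c≡grandparent = trans (unique c (parent-adj c≢r)) (sym (unique _ (symm T (parent-adj p≢r))))

    ancestor-not-leaf : ∀ {u v} → u ≺ v → ¬ Leaf T u
    ancestor-not-leaf (is-parent v≢r refl) = parent-not-leaf v≢r
    ancestor-not-leaf (via-parent _ u≺p)   = ancestor-not-leaf u≺p

module ChandelierLayout {N} (T : Graph N) (tree : IsTree T) (r : Fin N) (root-inner : ¬ Leaf T r) where
  open TreeRooting T tree r
  open Rooting rooting using (depth-parent)
  open Ancestry rooting
  open Intervals rooting

  -- the frame of a vertex at depth d starts at 2d + 1 and that of an inner
  -- vertex is three wide: it overlaps its parent's frame in x but ends
  -- before the frames of its grandchildren start
  column : ℕ → ℕ
  column d = 2 * d + 1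

  column-suc : ∀ d → column (suc d) ≡ 2 + column d
  column-suc d = cong (_+ 1) (ℕₚ.*-suc 2 d)

  column-mono : ∀ {d e} → d ≤ e → column d ≤ column e
  column-mono d≤e = ℕₚ.+-monoˡ-≤ 1 (ℕₚ.*-monoʳ-≤ 2 d≤e)

  column-pos : ∀ d → 0 < column d
  column-pos d = ℕₚ.m≤n+m 1 (2 * d)

  left : Fin N → ℕ
  left v = column (depth v)

  -- the frame of an inner vertex is three columns wide; that of a leaf
  -- reaches past the right side of the pivot frame
  rightEnd : ∀ v → Dec (Leaf T v) → ℕ
  rightEnd v (yes _) = column height + 5
  rightEnd v (no _)  = left v + 3

  right : Fin N → ℕ
  right v = rightEnd v (leaf? T tree v)

  right-leaf : ∀ {v} → Leaf T v → right v ≡ column height + 5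
  right-leaf {v} leaf with leaf? T tree v
  ... | yes _    = refl
  ... | no inner = ⊥-elim (inner leaf)

  right-inner : ∀ {v} → ¬ Leaf T v → right v ≡ left v + 3
  right-inner {v} inner with leaf? T tree v
  ... | yes leaf = ⊥-elim (inner leaf)
  ... | no _     = refl

  left+3≤right : ∀ v → left v + 3 ≤ right v
  left+3≤right v with leaf? T tree v
  ... | yes _ = ℕₚ.+-mono-≤ (column-mono (depth≤height v)) (ℕₚ.m≤n+m 3 2)
  ... | no _  = ℕₚ.≤-refl

  high≤high-root : ∀ v → high v ≤ high r
  high≤high-root v with v ≟ r
  ... | yes refl = ℕₚ.≤-refl
  ... | no  v≢r  = ℕₚ.<⇒≤ (proj₂ (ancestor-inside (root≺ v≢r)))

  vertexFrame : Fin N → GridFrame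
  vertexFrame v = record { x₀ = left v ; x₁ = right v ; y₀ = low v ; y₁ = high v
                         ; x₀<x₁ = ℕₚ.<-≤-trans (ℕₚ.m<m+n (left v) (s≤s z≤n)) (left+3≤right v)
                         ; y₀<y₁ = low<high v }

  pivotFrame : GridFrame
  pivotFrame = record { x₀ = 0 ; x₁ = column height + 4 ; y₀ = 0 ; y₁ = suc (high r)
                      ; x₀<x₁ = ℕₚ.<-≤-trans (column-pos height) (ℕₚ.m≤m+n _ 4)
                      ; y₀<y₁ = s≤s z≤n }

  frame : Fin (suc N) → GridFrame
  frame zero    = pivotFrame
  frame (suc v) = vertexFrame v

  open FrameLayout (chandelier T) frame

  left<pivot : ∀ v → left v < column height + 4
  left<pivot v = ℕₚ.≤-<-trans (column-mono (depth≤height v)) (ℕₚ.m<m+n _ (s≤s z≤n))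

  pivot-lowest : ∀ v → ¬ low v ≤ 0
  pivot-lowest v lv≤0 = ℕₚ.<-irrefl refl (ℕₚ.≤-trans (low-pos v) lv≤0)

  leaf-crossing : ∀ {v} → Leaf T v → Crossing pivotFrame (vertexFrame v)
  leaf-crossing {v} leaf =
    (column-pos (depth v) , left<pivot v ,
     subst (column height + 4 <_) (sym (right-leaf leaf)) (ℕₚ.+-monoʳ-< (column height) (ℕₚ.n<1+n 4))) ,
    (low-pos v , s≤s (high≤high-root v))

  -- ... and nothing fits in their overlap: only v itself and its
  -- descendants have intervals inside that of v, and v has none
  leaf-clear : ∀ {v} → Leaf T v → Clear zero (suc v)
  leaf-clear {v} leaf zero    (_ , (lv≤0 , _)) = pivot-lowest v lv≤0
  leaf-clear {v} leaf (suc w) ((_ , rw≤) , (lv≤lw , hw≤hv)) with inside⇒≼ lv≤lw hw≤hv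
  ... | inj₁ refl = ℕₚ.<⇒≱ (ℕₚ.+-monoʳ-< (column height) (ℕₚ.n<1+n 4))
                      (subst (_≤ column height + 4) (right-leaf leaf) rw≤)
  ... | inj₂ v≺w  = ancestor-not-leaf root-inner v≺w leaf

  inner-inside : ∀ {v} → ¬ Leaf T v → Inside (vertexFrame v) pivotFrame
  inner-inside {v} inner =
    (column-pos (depth v) ,
     subst (_< column height + 4) (sym (right-inner inner))
       (ℕₚ.+-mono-≤-< (column-mono (depth≤height v)) (ℕₚ.n<1+n 3))) ,
    (low-pos v , s≤s (high≤high-root v))

  pivot-fits : ∀ v → Fits zero (suc v)
  pivot-fits v with leaf? T tree v
  ... | yes leaf  = crosses leaf (leaf-crossing leaf) (leaf-clear leaf)
  ... | no  inner = separate inner (encloses (inner-inside inner))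

  module _ {v} (v≢r : v ≢ r) where
    private
      u = parent v
      left-child : left v ≡ 2 + left u
      left-child = trans (cong column (sym (depth-parent v≢r))) (column-suc (depth u))
      right-parent : right u ≡ left u + 3
      right-parent = right-inner (parent-not-leaf root-inner v≢r)
      -- every frame starting at or right of the child's left side ends
      -- right of the parent's frame
      parent-ends-first : right u < left v + 3
      parent-ends-first = begin-strict
        right u          ≡⟨ right-parent ⟩
        left u + 3       <⟨ ℕₚ.+-monoˡ-< 3 (ℕₚ.m<n+m (left u) {2} (s≤s z≤n)) ⟩
        2 + left u + 3   ≡⟨ cong (_+ 3) left-child ⟨
        left v + 3       ∎
        where open ℕₚ.≤-Reasoning

    child-crossing : Crossing (vertexFrame u) (vertexFrame v)
    child-crossing = (parent-starts-first , child-starts-inside , child-ends-outside) , child-inside v≢r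
      where
      parent-starts-first : left u < left v
      parent-starts-first = subst (left u <_) (sym left-child) (ℕₚ.m<n+m (left u) {2} (s≤s z≤n))
      child-starts-inside : left v < right u
      child-starts-inside = begin-strict
        left v       ≡⟨ left-child ⟩
        2 + left u   ≡⟨ ℕₚ.+-comm 2 (left u) ⟩
        left u + 2   <⟨ ℕₚ.+-monoʳ-< (left u) (ℕₚ.n<1+n 2) ⟩
        left u + 3   ≡⟨ right-parent ⟨
        right u      ∎
        where open ℕₚ.≤-Reasoning
      child-ends-outside : right u < right v
      child-ends-outside = ℕₚ.<-≤-trans parent-ends-first (left+3≤right v)

    child-clear : Clear (suc u) (suc v)
    child-clear zero    (_ , (lv≤0 , _)) = pivot-lowest v lv≤0
    child-clear (suc w) ((lv≤lw , rw≤ru) , _) =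
      ℕₚ.<⇒≱ parent-ends-first (ℕₚ.≤-trans (ℕₚ.+-monoˡ-≤ 3 lv≤lw) (ℕₚ.≤-trans (left+3≤right w) rw≤ru))

  far-ancestor-left : ∀ {u v} → v ≢ r → u ≺ parent v → right u < left v
  far-ancestor-left {u} {v} v≢r u≺p = begin-strict
    right u                         ≡⟨ right-inner (ancestor-not-leaf root-inner u≺p) ⟩
    left u + 3                      <⟨ ℕₚ.+-monoʳ-< (left u) (ℕₚ.n<1+n 3) ⟩
    left u + 4                      ≡⟨ ℕₚ.+-comm (left u) 4 ⟩
    2 + (2 + left u)                ≡⟨ trans (column-suc (suc (depth u))) (cong (2 +_) (column-suc (depth u))) ⟨
    column (suc (suc (depth u)))    ≤⟨ column-mono (s≤s (≺-depth u≺p)) ⟩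
    column (suc (depth (parent v))) ≡⟨ cong column (depth-parent v≢r) ⟩
    left v                          ∎
    where open ℕₚ.≤-Reasoning

  ancestor-fits : ∀ {u v} → u ≺ v → Fits (suc u) (suc v)
  ancestor-fits (is-parent v≢r refl) = crosses (parent-adj v≢r) (child-crossing v≢r) (child-clear v≢r)
  ancestor-fits {u} {v} (via-parent v≢r u≺p) = separate not-adjacent (left-of (far-ancestor-left v≢r u≺p))
    where
    not-adjacent : ¬ Adj T u v
    not-adjacent adj with edge⇒link adj
    ... | inj₁ (_ , refl)       = ≺-irrefl u≺p
    ... | inj₂ (u≢r , refl)     = ≺-asym (is-parent u≢r refl) (via-parent v≢r u≺p)

  disjoint-fits : ∀ {u v} → Disjoint u v → Fits (suc u) (suc v)
  disjoint-fits {u} {v} u∥v = separate not-adjacent (apart u∥v)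
    where
    apart : Disjoint u v → Apart (vertexFrame u) (vertexFrame v)
    apart (inj₁ hu<lv) = below hu<lv
    apart (inj₂ hv<lu) = above hv<lu
    not-adjacent : ¬ Adj T u v
    not-adjacent adj with edge⇒link adj
    ... | inj₁ (v≢r , u≡pv) = ancestor⇒¬disjoint (is-parent v≢r u≡pv) u∥v
    ... | inj₂ (u≢r , v≡pu) = ancestor⇒¬disjoint (is-parent u≢r v≡pu) (Sum.swap u∥v)

  vertex-fits : ∀ u v → u ≢ v → Fits (suc u) (suc v)
  vertex-fits u v u≢v with relative u v
  ... | same u≡v        = ⊥-elim (u≢v u≡v)
  ... | ancestor u≺v    = ancestor-fits u≺v
  ... | descendant v≺u  = fits-sym (ancestor-fits v≺u)
  ... | disjoint u∥v    = disjoint-fits u∥v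

  fits : ∀ x y → x ≢ y → Fits x y
  fits zero    zero    x≢y = ⊥-elim (x≢y refl)
  fits zero    (suc v) _   = pivot-fits v
  fits (suc u) zero    _   = fits-sym (pivot-fits u)
  fits (suc u) (suc v) x≢y = vertex-fits u v (λ u≡v → x≢y (cong suc u≡v))

  chandelier-representation : RestrictedFrameRep (chandelier T)
  chandelier-representation = representation fits

-- The chandelier of the one-edge tree is a triangle; three pairwise
-- crossing frames represent it.
module SingleEdge (T : Graph 2) (connected : Connected T) where

  crossing? : ∀ F G → Dec (Crossing F G)
  crossing? F G = ((x₀ F <? x₀ G) ×-dec (x₀ G <? x₁ F) ×-dec (x₁ F <? x₁ G)) ×-dec
                  ((y₀ F <? y₀ G) ×-dec (y₁ G <? y₁ F))

  inOverlap? : ∀ W F G → Dec (InOverlap W F G)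
  inOverlap? W F G = ((x₀ G ≤? x₀ W) ×-dec (x₁ W ≤? x₁ F)) ×-dec ((y₀ G ≤? y₀ W) ×-dec (y₁ W ≤? y₁ G))

  frame : Fin 3 → GridFrame
  frame zero             = record { x₀ = 0 ; x₁ = 10 ; y₀ = 0 ; y₁ = 10
                                  ; x₀<x₁ = toWitness {a? = 0 <? 10} tt ; y₀<y₁ = toWitness {a? = 0 <? 10} tt }
  frame (suc zero)       = record { x₀ = 5 ; x₁ = 15 ; y₀ = 2 ; y₁ = 8
                                  ; x₀<x₁ = toWitness {a? = 5 <? 15} tt ; y₀<y₁ = toWitness {a? = 2 <? 8} tt }
  frame (suc (suc zero)) = record { x₀ = 9 ; x₁ = 20 ; y₀ = 3 ; y₁ = 7
                                  ; x₀<x₁ = toWitness {a? = 9 <? 20} tt ; y₀<y₁ = toWitness {a? = 3 <? 7} tt }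

  open FrameLayout (chandelier T) frame

  crossing-clear : ∀ u v → Crossing (frame u) (frame v) → Clear u v
  crossing-clear = toWitness {a? = all? λ u → all? λ v → crossing? (frame u) (frame v) →-dec
                                     all? λ w → ¬? (inOverlap? (frame w) (frame u) (frame v))} tt

  crossing-pair : ∀ u v → Adj (chandelier T) u v → {True (crossing? (frame u) (frame v))} → Fits u v
  crossing-pair u v adj {c} = crosses adj (toWitness c) (crossing-clear u v (toWitness c))

  edge : Adj T zero (suc zero)
  edge with connected zero (suc zero)
  ... | _◅_ {j = zero}     adj _ = ⊥-elim (irrefl T adj)
  ... | _◅_ {j = suc zero} adj _ = adj

  leaf₀ : Leaf T zero
  leaf₀ = suc zero , edge , other
    where
    other : ∀ w → Adj T zero w → w ≡ suc zero
    other zero       adj = ⊥-elim (irrefl T adj)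
    other (suc zero) _   = refl

  leaf₁ : Leaf T (suc zero)
  leaf₁ = zero , symm T edge , other
    where
    other : ∀ w → Adj T (suc zero) w → w ≡ zero
    other zero       _   = refl
    other (suc zero) adj = ⊥-elim (irrefl T adj)

  fits : ∀ x y → x ≢ y → Fits x y
  fits zero             zero             x≢y = ⊥-elim (x≢y refl)
  fits zero             (suc zero)       _   = crossing-pair zero (suc zero) leaf₀
  fits zero             (suc (suc zero)) _   = crossing-pair zero (suc (suc zero)) leaf₁
  fits (suc zero)       zero             _   = fits-sym (fits zero (suc zero) λ ())
  fits (suc zero)       (suc zero)       x≢y = ⊥-elim (x≢y refl)
  fits (suc zero)       (suc (suc zero)) _   = crossing-pair (suc zero) (suc (suc zero)) edge
  fits (suc (suc zero)) zero             _   = fits-sym (fits zero (suc (suc zero)) λ ())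
  fits (suc (suc zero)) (suc zero)       _   = fits-sym (fits (suc zero) (suc (suc zero)) λ ())
  fits (suc (suc zero)) (suc (suc zero)) x≢y = ⊥-elim (x≢y refl)

  single-edge-representation : RestrictedFrameRep (chandelier T)
  single-edge-representation = representation fits

-- In a connected graph on at least three vertices, not every vertex is a
-- leaf: otherwise the component of vertex 0 would be 0 and its neighbour only.
not-all-leaves : ∀ {m} (T : Graph (3 + m)) → Connected T → ¬ (∀ v → Leaf T v)
not-all-leaves T connected all-leaves with all-leaves zero
... | u , adj₀ , unique₀ =
  two-vertices (component (connected zero (suc zero))) (component (connected zero (suc (suc zero))))
  where
  Near : Fin _ → Set
  Near x = x ≡ zero ⊎ x ≡ u

  closed : ∀ {x y} → Near x → Adj T x y → Near y
  closed (inj₁ refl) adj = inj₂ (unique₀ _ adj)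
  closed (inj₂ refl) adj with all-leaves u
  ... | _ , _ , uniqueᵤ = inj₁ (trans (uniqueᵤ _ adj) (sym (uniqueᵤ zero (symm T adj₀))))

  component : ∀ {y} → Star (Adj T) zero y → Near y
  component = go (inj₁ refl)
    where
    go : ∀ {x y} → Near x → Star (Adj T) x y → Near y
    go near ε            = near
    go near (adj ◅ walk) = go (closed near adj) walk

  two-vertices : Near (suc zero) → Near (suc (suc zero)) → ⊥
  two-vertices (inj₂ refl) (inj₂ ())

-- One vertex: it is isolated, hence an inner root.  Two vertices: the
-- explicit triangle.  More: root the tree at any vertex that is not a leaf.
lemma1 : ∀ (n : ℕ) (T : Graph (suc n)) → IsTree T → RestrictedFrameGraph (chandelier T)
lemma1 zero          T tree = ChandelierLayout.chandelier-representation T tree zero isolated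
  where
  isolated : ¬ Leaf T zero
  isolated (zero , adj , _) = irrefl T adj
lemma1 (suc zero)    T tree = SingleEdge.single-edge-representation T (proj₁ tree)
lemma1 (suc (suc m)) T tree with ¬∀⟶∃¬ _ (Leaf T) (leaf? T tree) (not-all-leaves T (proj₁ tree))
... | r , inner = ChandelierLayout.chandelier-representation T tree r inner
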